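{- Let $\mathbf{a}$ and $\mathbf{b}$ be density-1 generic degrees. Then $\mathbf{b}\geq_g\mathbf{a}$ if and only if there exist $B\in\mathbf{b}$ and $A\in\mathbf{a}$ such that $A$ and $B$ are both density-1 and $B\subseteq A$.
   Context: Reals are subsets of $\mathbb{N}$; $n=\{0,\dots,n-1\}$; a real $A$ is density-1 if $\lim_{n\to\infty}|A\cap n|/n=1$. A partial oracle for a real $C$ is a set $(C)$ of triples $\langle n,x,l\rangle$ (coded as naturals, usable as a Turing oracle) such that $\langle n,0,l\rangle\in(C)$ implies $n\notin C$ and $\langle n,1,l\rangle\in(C)$ implies $n\in C$; $\mathrm{dom}((C))=\{n:\exists x,l\ \langle n,x,l\rangle\in(C)\}$. A generic oracle for $C$ is a partial oracle for $C$ with density-1 domain. $\varphi^X$ is a generic computation of $D$ if $\mathrm{dom}(\varphi^X)$ is density-1, $\varphi^X$ has values in $\{0,1\}$, and agrees with $D$ on its domain. $C\geq_g D$ if there is a single Turing functional $\varphi$ such that for every generic oracle $(C)$ for $C$, $\varphi^{(C)}$ is a generic computation of $D$. Generic degrees are equivalence classes under mutual $\geq_g$, ordered by $\geq_g$. A generic degree is density-1 if it contains a density-1 real. -}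

module Defs where

open import Level using (0ℓ)
open import Data.Nat using (ℕ; zero; suc; _+_; _*_; _/_; _≤_)
open import Data.Bool using (Bool; true; false)
open import Data.Vec using (Vec; []; _∷_; lookup)
open import Data.Fin using (Fin)
open import Data.Integer using (+_)
open import Data.Rational as ℚ using (ℚ; 0ℚ; 1ℚ; ∣_∣)
open import Data.Product using (Σ; ∃; _×_; _,_)
open import Data.Sum using (_⊎_)
open import Relation.Binary.PropositionalEquality using (_≡_)
open import Relation.Nullary using (¬_)

-- Reals: subsets of ℕ, as characteristic functions.

Real : Set
Real = ℕ → Bool

_⊆ᴿ_ : Real → Real → Set
B ⊆ᴿ A = ∀ n → B n ≡ true → A n ≡ true

data CountIs (P : ℕ → Set) : ℕ → ℕ → Set where
  cnt-zero : CountIs P 0 0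
  cnt-in   : ∀ {n c} → P n → CountIs P n c → CountIs P (suc n) (suc c)
  cnt-out  : ∀ {n c} → ¬ P n → CountIs P n c → CountIs P (suc n) c

Density1ᴾ : (ℕ → Set) → Set
Density1ᴾ P =
  ∀ (ε : ℚ) → 0ℚ ℚ.< ε →
  ∃ λ N → ∀ m → N ≤ m → ∀ c → CountIs P (suc m) c →
    ∣ ((+ c) ℚ./ suc m) ℚ.- 1ℚ ∣ ℚ.< ε

Density1 : Real → Set
Density1 A = Density1ᴾ (λ n → A n ≡ true)

-- Coding of pairs / triples of naturals (Cantor pairing, a bijection
-- ℕ × ℕ → ℕ).

pair : ℕ → ℕ → ℕ
pair a b = ((a + b) * suc (a + b)) / 2 + b

triple : ℕ → ℕ → ℕ → ℕ
triple n x l = pair n (pair x l)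

-- Turing functionals: partial recursive (μ-recursive) functions
-- relative to an oracle X : ℕ → Bool.  Code k = programs of arity k.

data Code : ℕ → Set where
  zer    : ∀ {k} → Code k
  succ   : Code 1
  proj   : ∀ {k} → Fin k → Code k
  comp   : ∀ {k m} → Code m → Vec (Code k) m → Code k
  prec   : ∀ {k} → Code k → Code (suc (suc k)) → Code (suc k)
  mu     : ∀ {k} → Code (suc k) → Code k
  oracle : Code 1

-- Big-step semantics: Eval X f xs v  means  f^X(xs) ↓ = v.
mutual
  data Eval (X : ℕ → Bool) : ∀ {k} → Code k → Vec ℕ k → ℕ → Set where
    ev-zer    : ∀ {k} {xs : Vec ℕ k} → Eval X zer xs 0
    ev-succ   : ∀ {x} → Eval X succ (x ∷ []) (suc x)
    ev-proj   : ∀ {k} {i : Fin k} {xs} → Eval X (proj i) xs (lookup xs i)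
    ev-comp   : ∀ {k m} {f : Code m} {gs : Vec (Code k) m} {xs ys v} →
                EvalAll X gs xs ys → Eval X f ys v → Eval X (comp f gs) xs v
    ev-prec-z : ∀ {k} {f : Code k} {g xs v} →
                Eval X f xs v → Eval X (prec f g) (0 ∷ xs) v
    ev-prec-s : ∀ {k} {f : Code k} {g n xs r v} →
                Eval X (prec f g) (n ∷ xs) r →
                Eval X g (n ∷ r ∷ xs) v → Eval X (prec f g) (suc n ∷ xs) v
    ev-mu     : ∀ {k} {f : Code (suc k)} {xs y} →
                Eval X f (y ∷ xs) 0 →
                (∀ z → Data.Nat._<_ z y → Σ ℕ λ w → Eval X f (z ∷ xs) (suc w)) →
                Eval X (mu f) xs y
    ev-orc-t  : ∀ {x} → X x ≡ true  → Eval X oracle (x ∷ []) 1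
    ev-orc-f  : ∀ {x} → X x ≡ false → Eval X oracle (x ∷ []) 0

  data EvalAll (X : ℕ → Bool) {k} : ∀ {m} → Vec (Code k) m → Vec ℕ k → Vec ℕ m → Set where
    ea-nil  : ∀ {xs} → EvalAll X [] xs []
    ea-cons : ∀ {m} {g} {gs : Vec (Code k) m} {xs v vs} →
              Eval X g xs v → EvalAll X gs xs vs → EvalAll X (g ∷ gs) xs (v ∷ vs)

Functional : Set
Functional = Code 1

PartialOracle : Real → (ℕ → Bool) → Set
PartialOracle C X =
  ∀ n x l → X (triple n x l) ≡ true →
    (x ≡ 0 × C n ≡ false) ⊎ (x ≡ 1 × C n ≡ true)

dom : (ℕ → Bool) → ℕ → Set
dom X n = ∃ λ x → ∃ λ l → X (triple n x l) ≡ true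

GenericOracle : Real → (ℕ → Bool) → Set
GenericOracle C X = PartialOracle C X × Density1ᴾ (dom X)

GenericComputation : Functional → (ℕ → Bool) → Real → Set
GenericComputation φ X D =
  Density1ᴾ (λ n → ∃ λ v → Eval X φ (n ∷ []) v) ×
  (∀ n v → Eval X φ (n ∷ []) v →
     (v ≡ 0 × D n ≡ false) ⊎ (v ≡ 1 × D n ≡ true))

_≥g_ : Real → Real → Set
C ≥g D = ∃ λ (φ : Functional) →
  ∀ (X : ℕ → Bool) → GenericOracle C X → GenericComputation φ X D

_≡g_ : Real → Real → Set
C ≡g D = (C ≥g D) × (D ≥g C)

module Submission where

-- (⇒) Take A = A₀ and B = A₀ ∩ B₀, which is again density-1.  A
-- density-1 set D reduces to each superset C: on input n, wait for
-- positive information ⟨n,1,l⟩ in the oracle and answer 1.  This gives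
-- B ≥g B₀ and A₀ ≥g A₀.  Conversely B₀ ≥g A₀ ∩ B₀: run the reduction of
-- A₀ to B₀ and in addition wait for positive information about B₀.
-- (⇐) Let B₀ ≥g B via φ and A ≥g A₀ via ψ.  For a generic oracle X of
-- B₀, the triples ⟨n,1,l⟩ such that φ^X(n) = 1 is found by stage l form
-- a generic oracle for A (because B ⊆ A and B is density-1), and this
-- oracle is uniformly computable from X.  Substituting its computation
-- for the oracle queries of ψ witnesses B₀ ≥g A₀.

open import Defs
open import Data.Product using (∃; _×_)
open import Function.Bundles using (_⇔_; mk⇔)

module Density where

  open import Data.Nat using (ℕ; zero; suc; _+_; _∸_; _≤_; z≤n; s≤s; _⊔_)
  import Data.Nat.Properties as ℕP
  open import Data.Integer as ℤ using (+_)
  import Data.Integer.Properties as ℤP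
  open import Data.Rational as ℚ using (ℚ; 0ℚ; 1ℚ; ∣_∣; toℚᵘ)
  import Data.Rational.Properties as ℚP
  open import Data.Rational.Unnormalised as ℚᵘ using (mkℚᵘ; *≡*; *≤*)
  import Data.Rational.Unnormalised.Properties as ℚᵘP
  open import Data.Product using (∃; _×_; _,_)
  open import Data.Sum using (_⊎_; inj₁; inj₂)
  open import Data.Empty using (⊥-elim)
  open import Relation.Nullary using (¬_)
  open import Relation.Nullary.Decidable using (decidable-stable)
  open import Relation.Binary.PropositionalEquality

  ratio : ℕ → ℕ → ℚ
  ratio p m = (+ p) ℚ./ suc m

  ratio-ᵘ : ∀ p m → toℚᵘ (ratio p m) ℚᵘ.≃ mkℚᵘ (+ p) m
  ratio-ᵘ p m = ℚP.toℚᵘ-fromℚᵘ (mkℚᵘ (+ p) m)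

  ratio-mono : ∀ {p q} m → p ≤ q → ratio p m ℚ.≤ ratio q m
  ratio-mono {p} {q} m p≤q = ℚP.toℚᵘ-cancel-≤
    (ℚᵘP.≤-respˡ-≃ (ℚᵘP.≃-sym (ratio-ᵘ p m)) (ℚᵘP.≤-respʳ-≃ (ℚᵘP.≃-sym (ratio-ᵘ q m))
      (*≤* (ℤP.*-monoʳ-≤-nonNeg (+ suc m) (ℤ.+≤+ p≤q)))))

  ratio-+ : ∀ p q m → ratio p m ℚ.+ ratio q m ≡ ratio (p + q) m
  ratio-+ p q m = ℚP.toℚᵘ-injective (ℚᵘP.≃-trans (ℚP.toℚᵘ-homo-+ (ratio p m) (ratio q m))
    (ℚᵘP.≃-trans (ℚᵘP.+-cong (ratio-ᵘ p m) (ratio-ᵘ q m))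
    (ℚᵘP.≃-trans (*≡* cross) (ℚᵘP.≃-sym (ratio-ᵘ (p + q) m)))))
    where
    open import Data.Integer.Solver using (module +-*-Solver)
    open +-*-Solver
    d : ℤ.ℤ
    d = + suc m
    cross : (+ p ℤ.* d ℤ.+ + q ℤ.* d) ℤ.* d ≡ + (p + q) ℤ.* (d ℤ.* d)
    cross rewrite ℤP.pos-+ p q =
      solve 3 (λ x y z → (x :* z :+ y :* z) :* z := (x :+ y) :* (z :* z)) refl (+ p) (+ q) d

  ratio-full : ∀ m → ratio (suc m) m ≡ 1ℚ
  ratio-full m = ℚP.toℚᵘ-injective (ℚᵘP.≃-trans (ratio-ᵘ (suc m) m) (*≡* (ℤP.*-comm (+ suc m) (+ 1))))

  ratio-nonneg : ∀ p m → 0ℚ ℚ.≤ ratio p m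
  ratio-nonneg p m = subst (ℚ._≤ ratio p m) (ℚP.0/n≡0 (suc m)) (ratio-mono {0} {p} m z≤n)

  distance-from-1 : ∀ c m → c ≤ suc m → ∣ ratio c m ℚ.- 1ℚ ∣ ≡ ratio (suc m ∸ c) m
  distance-from-1 c m c≤ = begin
      ∣ ratio c m ℚ.- 1ℚ ∣
    ≡⟨ cong (λ z → ∣ ratio c m ℚ.- z ∣) (sym whole) ⟩
      ∣ ratio c m ℚ.- (ratio c m ℚ.+ ratio d m) ∣
    ≡⟨ cong ∣_∣ (solve 2 (λ x y → x :- (x :+ y) := :- y) refl (ratio c m) (ratio d m)) ⟩
      ∣ ℚ.- ratio d m ∣
    ≡⟨ ℚP.∣-p∣≡∣p∣ (ratio d m) ⟩
      ∣ ratio d m ∣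
    ≡⟨ ℚP.0≤p⇒∣p∣≡p (ratio-nonneg d m) ⟩
      ratio d m ∎
    where
    open ≡-Reasoning
    open import Data.Rational.Solver using (module +-*-Solver)
    open +-*-Solver
    d : ℕ
    d = suc m ∸ c
    whole : ratio c m ℚ.+ ratio d m ≡ 1ℚ
    whole = trans (ratio-+ c d m) (trans (cong (λ z → ratio z m) (ℕP.m+[n∸m]≡n c≤)) (ratio-full m))

  count-≤ : ∀ {P n c} → CountIs P n c → c ≤ n
  count-≤ cnt-zero = z≤n
  count-≤ (cnt-in _ k) = s≤s (count-≤ k)
  count-≤ (cnt-out _ k) = ℕP.m≤n⇒m≤1+n (count-≤ k)

  count-mono : ∀ {P Q : ℕ → Set} → (∀ n → P n → Q n) →
    ∀ {n a b} → CountIs P n a → CountIs Q n b → a ≤ b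
  count-mono P⊆Q cnt-zero cnt-zero = z≤n
  count-mono P⊆Q (cnt-in p k) (cnt-in q k') = s≤s (count-mono P⊆Q k k')
  count-mono P⊆Q (cnt-in p k) (cnt-out ¬q k') = ⊥-elim (¬q (P⊆Q _ p))
  count-mono P⊆Q (cnt-out _ k) (cnt-in q k') = ℕP.m≤n⇒m≤1+n (count-mono P⊆Q k k')
  count-mono P⊆Q (cnt-out _ k) (cnt-out _ k') = count-mono P⊆Q k k'

  count-∩ : ∀ {P Q : ℕ → Set} {n a b c} → CountIs P n a → CountIs Q n b →
    CountIs (λ i → P i × Q i) n c → a + b ≤ n + c
  count-∩ cnt-zero cnt-zero cnt-zero = z≤n
  count-∩ {a = suc a} {suc b} {c = suc c} (cnt-in _ k₁) (cnt-in _ k₂) (cnt-in _ k₃) =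
    subst₂ _≤_ (sym (cong suc (ℕP.+-suc a b))) (sym (cong suc (ℕP.+-suc _ c)))
      (s≤s (s≤s (count-∩ k₁ k₂ k₃)))
  count-∩ (cnt-in p _) (cnt-in q _) (cnt-out ¬pq _) = ⊥-elim (¬pq (p , q))
  count-∩ (cnt-in _ _) (cnt-out ¬q _) (cnt-in (_ , q) _) = ⊥-elim (¬q q)
  count-∩ (cnt-in _ k₁) (cnt-out _ k₂) (cnt-out _ k₃) = s≤s (count-∩ k₁ k₂ k₃)
  count-∩ (cnt-out ¬p _) (cnt-in _ _) (cnt-in (p , _) _) = ⊥-elim (¬p p)
  count-∩ {n = suc n} {a = a} {suc b} {c = c} (cnt-out _ k₁) (cnt-in _ k₂) (cnt-out _ k₃) =
    subst (_≤ suc (n + c)) (sym (ℕP.+-suc a b)) (s≤s (count-∩ k₁ k₂ k₃))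
  count-∩ (cnt-out ¬p _) (cnt-out _ _) (cnt-in (p , _) _) = ⊥-elim (¬p p)
  count-∩ (cnt-out _ k₁) (cnt-out _ k₂) (cnt-out _ k₃) = ℕP.m≤n⇒m≤1+n (count-∩ k₁ k₂ k₃)

  -- P need not be decidable, so a count of a prefix exists only
  -- classically; since the goals below are decidable this suffices.
  count-exists : (P : ℕ → Set) → ∀ n → ¬ ¬ (∃ λ c → CountIs P n c)
  count-exists P zero k = k (0 , cnt-zero)
  count-exists P (suc n) k =
    count-exists P n (λ (c , ct) → excluded-middle (extend c ct))
    where
    excluded-middle : ¬ ¬ (P n ⊎ ¬ P n)
    excluded-middle h = h (inj₂ (λ p → h (inj₁ p)))
    extend : ∀ c → CountIs P n c → ¬ (P n ⊎ ¬ P n)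
    extend c ct (inj₁ p) = k (suc c , cnt-in p ct)
    extend c ct (inj₂ ¬p) = k (c , cnt-out ¬p ct)

  missing : ℕ → ℕ → ℚ
  missing c m = ∣ ratio c m ℚ.- 1ℚ ∣

  density1-mono : ∀ {P Q : ℕ → Set} → (∀ n → P n → Q n) → Density1ᴾ P → Density1ᴾ Q
  density1-mono {P} {Q} P⊆Q dP ε ε>0 with dP ε ε>0
  ... | N , close = N , λ m N≤m c ctQ → decidable-stable (missing c m ℚP.<? ε)
    λ ¬goal → count-exists P (suc m) λ (a , ctP) → ¬goal (ℚP.≤-<-trans (fewer ctQ ctP) (close m N≤m a ctP))
    where
    fewer : ∀ {m c a} → CountIs Q (suc m) c → CountIs P (suc m) a → missing c m ℚ.≤ missing a m
    fewer {m} {c} {a} ctQ ctP =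
      subst₂ ℚ._≤_ (sym (distance-from-1 c m (count-≤ ctQ))) (sym (distance-from-1 a m (count-≤ ctP)))
        (ratio-mono m (ℕP.∸-monoʳ-≤ (suc m) (count-mono P⊆Q ctP ctQ)))

  missing-∩ : ∀ n a b c → a ≤ n → b ≤ n → a + b ≤ n + c → n ∸ c ≤ (n ∸ a) + (n ∸ b)
  missing-∩ n a b c a≤n b≤n ab≤nc = ℕP.m≤n+o⇒m∸n≤o n c (ℕP.+-cancelˡ-≤ n n _ twice)
    where
    open ℕP.≤-Reasoning
    open import Data.Nat.Solver using (module +-*-Solver)
    open +-*-Solver
    a' b' : ℕ
    a' = n ∸ a
    b' = n ∸ b
    twice : n + n ≤ n + (c + (a' + b'))
    twice = begin
        n + n
      ≡⟨ cong₂ _+_ (sym (ℕP.m+[n∸m]≡n a≤n)) (sym (ℕP.m+[n∸m]≡n b≤n)) ⟩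
        (a + a') + (b + b')
      ≡⟨ solve 4 (λ x x' y y' → (x :+ x') :+ (y :+ y') := (x :+ y) :+ (x' :+ y')) refl a a' b b' ⟩
        (a + b) + (a' + b')
      ≤⟨ ℕP.+-monoˡ-≤ (a' + b') ab≤nc ⟩
        (n + c) + (a' + b')
      ≡⟨ ℕP.+-assoc n c (a' + b') ⟩
        n + (c + (a' + b')) ∎

  half : ℚ → ℚ
  half ε = ε ℚ.* ℚ.½

  half-pos : ∀ ε → 0ℚ ℚ.< ε → 0ℚ ℚ.< half ε
  half-pos ε ε>0 = subst (ℚ._< half ε) (ℚP.*-zeroˡ ℚ.½) (ℚP.*-monoˡ-<-pos ℚ.½ ε>0)

  half+half : ∀ ε → half ε ℚ.+ half ε ≡ ε
  half+half ε = trans (sym (ℚP.*-distribˡ-+ ε ℚ.½ ℚ.½)) (ℚP.*-identityʳ ε)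

  density1-∩ : ∀ {P Q : ℕ → Set} → Density1ᴾ P → Density1ᴾ Q → Density1ᴾ (λ n → P n × Q n)
  density1-∩ {P} {Q} dP dQ ε ε>0 with dP (half ε) (half-pos ε ε>0) | dQ (half ε) (half-pos ε ε>0)
  ... | N₁ , closeP | N₂ , closeQ = N₁ ⊔ N₂ , λ m N≤m c ct → decidable-stable (missing c m ℚP.<? ε)
    λ ¬goal → count-exists P (suc m) λ (a , ctP) → count-exists Q (suc m) λ (b , ctQ) →
      ¬goal (ℚP.≤-<-trans (subadditive ct ctP ctQ)
        (subst (missing a m ℚ.+ missing b m ℚ.<_) (half+half ε)
          (ℚP.+-mono-< (closeP m (ℕP.≤-trans (ℕP.m≤m⊔n N₁ N₂) N≤m) a ctP)
                       (closeQ m (ℕP.≤-trans (ℕP.m≤n⊔m N₁ N₂) N≤m) b ctQ))))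
    where
    subadditive : ∀ {m a b c} → CountIs (λ n → P n × Q n) (suc m) c →
      CountIs P (suc m) a → CountIs Q (suc m) b → missing c m ℚ.≤ missing a m ℚ.+ missing b m
    subadditive {m} {a} {b} {c} ct ctP ctQ =
      subst₂ ℚ._≤_ (sym (distance-from-1 c m (count-≤ ct)))
        (trans (sym (ratio-+ (suc m ∸ a) (suc m ∸ b) m))
               (sym (cong₂ ℚ._+_ (distance-from-1 a m (count-≤ ctP)) (distance-from-1 b m (count-≤ ctQ)))))
        (ratio-mono m (missing-∩ (suc m) a b c (count-≤ ctP) (count-≤ ctQ) (count-∩ ctP ctQ ct)))

module Programs where

  open import Data.Nat as ℕ using (ℕ; zero; suc; _+_; _*_; _∸_)
  import Data.Nat.Properties as ℕP
  open import Data.Nat.DivMod using (m*n/n≡m)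
  open import Data.Bool using (Bool)
  open import Data.Vec using (Vec; []; _∷_)
  open import Data.Fin using (zero; suc)
  open import Data.Product using (proj₂)
  open import Data.Empty using (⊥-elim)
  open import Relation.Binary.PropositionalEquality
  open import Relation.Binary.Definitions using (tri<; tri≈; tri>)

  mutual
    eval-functional : ∀ {X k} {f : Code k} {xs v w} → Eval X f xs v → Eval X f xs w → v ≡ w
    eval-functional ev-zer ev-zer = refl
    eval-functional ev-succ ev-succ = refl
    eval-functional ev-proj ev-proj = refl
    eval-functional (ev-comp as e) (ev-comp as' e') with evalAll-functional as as'
    ... | refl = eval-functional e e'
    eval-functional (ev-prec-z e) (ev-prec-z e') = eval-functional e e'
    eval-functional (ev-prec-s e₁ e₂) (ev-prec-s e₁' e₂') with eval-functional e₁ e₁'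
    ... | refl = eval-functional e₂ e₂'
    eval-functional (ev-mu {y = y} e below) (ev-mu {y = y'} e' below') with ℕP.<-cmp y y'
    ... | tri< y<y' _ _ = ⊥-elim (ℕP.0≢1+n (eval-functional e (proj₂ (below' y y<y'))))
    ... | tri≈ _ y≡y' _ = y≡y'
    ... | tri> _ _ y'<y = ⊥-elim (ℕP.0≢1+n (sym (eval-functional (proj₂ (below y' y'<y)) e')))
    eval-functional (ev-orc-t p) (ev-orc-t q) = refl
    eval-functional (ev-orc-t p) (ev-orc-f q) with trans (sym p) q
    ... | ()
    eval-functional (ev-orc-f p) (ev-orc-t q) with trans (sym p) q
    ... | ()
    eval-functional (ev-orc-f p) (ev-orc-f q) = refl

    evalAll-functional : ∀ {X k m} {gs : Vec (Code k) m} {xs ys zs} →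
      EvalAll X gs xs ys → EvalAll X gs xs zs → ys ≡ zs
    evalAll-functional ea-nil ea-nil = refl
    evalAll-functional (ea-cons e as) (ea-cons e' as') =
      cong₂ _∷_ (eval-functional e e') (evalAll-functional as as')

  app1 : ∀ {k} → Code 1 → Code k → Code k
  app1 f g = comp f (g ∷ [])

  app2 : ∀ {k} → Code 2 → Code k → Code k → Code k
  app2 f g h = comp f (g ∷ h ∷ [])

  app3 : ∀ {k} → Code 3 → Code k → Code k → Code k → Code k
  app3 f g h i = comp f (g ∷ h ∷ i ∷ [])

  #0 : ∀ {k} → Code (suc k)
  #0 = proj zero

  #1 : ∀ {k} → Code (suc (suc k))
  #1 = proj (suc zero)

  #2 : ∀ {k} → Code (suc (suc (suc k)))
  #2 = proj (suc (suc zero))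

  #3 : ∀ {k} → Code (suc (suc (suc (suc k))))
  #3 = proj (suc (suc (suc zero)))

  oneC : ∀ {k} → Code k
  oneC = app1 succ zer

  ifZero : ℕ → ℕ → ℕ → ℕ
  ifZero zero a b = a
  ifZero (suc _) a b = b

  isEqual : ℕ → ℕ → ℕ
  isEqual a b = ifZero ((a ∸ b) + (b ∸ a)) 1 0

  -- Triangular numbers: pair a b = triangle (a + b) + b.
  triangle : ℕ → ℕ
  triangle zero = 0
  triangle (suc s) = triangle s + suc s

  predC : Code 1
  predC = prec zer #0

  ifZeroC : Code 3
  ifZeroC = prec #0 #3

  addC : Code 2
  addC = prec #0 (app1 succ #1)

  -- monusC n a = a ∸ n (recursion on the subtrahend).
  monusC : Code 2
  monusC = prec #0 (app1 predC #1)

  subC : Code 2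
  subC = app2 monusC #1 #0

  isEqualC : Code 2
  isEqualC = app3 ifZeroC (app2 addC (app2 subC #0 #1) (app2 subC #1 #0)) oneC zer

  triangleC : Code 1
  triangleC = prec zer (app2 addC #1 (app1 succ #0))

  pairC : Code 2
  pairC = app2 addC (app1 triangleC (app2 addC #0 #1)) #1

  tripleC : Code 3
  tripleC = app2 pairC #0 (app2 pairC #1 #2)

  module _ {X : ℕ → Bool} where
    ev-app1 : ∀ {k} {f : Code 1} {g : Code k} {xs a v} →
      Eval X g xs a → Eval X f (a ∷ []) v → Eval X (app1 f g) xs v
    ev-app1 eg ef = ev-comp (ea-cons eg ea-nil) ef

    ev-app2 : ∀ {k} {f : Code 2} {g h : Code k} {xs a b v} → Eval X g xs a → Eval X h xs b →
      Eval X f (a ∷ b ∷ []) v → Eval X (app2 f g h) xs v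
    ev-app2 eg eh ef = ev-comp (ea-cons eg (ea-cons eh ea-nil)) ef

    ev-app3 : ∀ {k} {f : Code 3} {g h i : Code k} {xs a b c v} → Eval X g xs a → Eval X h xs b →
      Eval X i xs c → Eval X f (a ∷ b ∷ c ∷ []) v → Eval X (app3 f g h i) xs v
    ev-app3 eg eh ei ef = ev-comp (ea-cons eg (ea-cons eh (ea-cons ei ea-nil))) ef

    ev-one : ∀ {k} {xs : Vec ℕ k} → Eval X oneC xs 1
    ev-one = ev-app1 ev-zer ev-succ

    ev-pred : ∀ n → Eval X predC (n ∷ []) (ℕ.pred n)
    ev-pred zero = ev-prec-z ev-zer
    ev-pred (suc n) = ev-prec-s (ev-pred n) ev-proj

    ev-ifZero : ∀ c a b → Eval X ifZeroC (c ∷ a ∷ b ∷ []) (ifZero c a b)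
    ev-ifZero zero a b = ev-prec-z ev-proj
    ev-ifZero (suc c) a b = ev-prec-s (ev-ifZero c a b) ev-proj

    ev-add : ∀ a b → Eval X addC (a ∷ b ∷ []) (a + b)
    ev-add zero b = ev-prec-z ev-proj
    ev-add (suc a) b = ev-prec-s (ev-add a b) (ev-app1 ev-proj ev-succ)

    ev-monus : ∀ n a → Eval X monusC (n ∷ a ∷ []) (a ∸ n)
    ev-monus zero a = ev-prec-z ev-proj
    ev-monus (suc n) a = subst (Eval X monusC (suc n ∷ a ∷ [])) (ℕP.pred[m∸n]≡m∸[1+n] a n)
      (ev-prec-s (ev-monus n a) (ev-app1 ev-proj (ev-pred (a ∸ n))))

    ev-sub : ∀ a b → Eval X subC (a ∷ b ∷ []) (a ∸ b)
    ev-sub a b = ev-app2 ev-proj ev-proj (ev-monus b a)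

    ev-isEqual : ∀ a b → Eval X isEqualC (a ∷ b ∷ []) (isEqual a b)
    ev-isEqual a b =
      ev-app3 (ev-app2 (ev-app2 ev-proj ev-proj (ev-sub a b)) (ev-app2 ev-proj ev-proj (ev-sub b a)) (ev-add _ _))
              ev-one ev-zer (ev-ifZero _ 1 0)

    ev-triangle : ∀ s → Eval X triangleC (s ∷ []) (triangle s)
    ev-triangle zero = ev-prec-z ev-zer
    ev-triangle (suc s) = ev-prec-s (ev-triangle s) (ev-app2 ev-proj (ev-app1 ev-proj ev-succ) (ev-add _ _))

  isEqual-refl : ∀ a → isEqual a a ≡ 1
  isEqual-refl a rewrite ℕP.n∸n≡0 a = refl

  isEqual-sound : ∀ a b {w} → isEqual a b ≡ suc w → a ≡ b
  isEqual-sound a b eq with (a ∸ b) + (b ∸ a) in diff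
  ... | zero = ℕP.≤-antisym (ℕP.m∸n≡0⇒m≤n (ℕP.m+n≡0⇒m≡0 (a ∸ b) diff))
                           (ℕP.m∸n≡0⇒m≤n (ℕP.m+n≡0⇒n≡0 (a ∸ b) diff))
  isEqual-sound a b () | suc _

  -- Cantor's pairing is computed by pairC since  triangle s = s(s+1)/2.
  double-triangle : ∀ s → triangle s * 2 ≡ s * suc s
  double-triangle zero = refl
  double-triangle (suc s) = begin
      (triangle s + suc s) * 2
    ≡⟨ ℕP.*-distribʳ-+ 2 (triangle s) (suc s) ⟩
      triangle s * 2 + suc s * 2
    ≡⟨ cong (_+ suc s * 2) (double-triangle s) ⟩
      s * suc s + suc s * 2
    ≡⟨ solve 1 (λ x → x :* (con 1 :+ x) :+ (con 1 :+ x) :* con 2 := (con 1 :+ x) :* (con 2 :+ x)) refl s ⟩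
      suc s * suc (suc s) ∎
    where
    open ≡-Reasoning
    open import Data.Nat.Solver using (module +-*-Solver)
    open +-*-Solver

  pair-triangle : ∀ a b → triangle (a + b) + b ≡ pair a b
  pair-triangle a b = cong (_+ b) (sym (trans (cong (ℕ._/ 2) (sym (double-triangle (a + b))))
                                              (m*n/n≡m (triangle (a + b)) 2)))

  module _ {X : ℕ → Bool} where
    ev-pair : ∀ a b → Eval X pairC (a ∷ b ∷ []) (pair a b)
    ev-pair a b = subst (Eval X pairC (a ∷ b ∷ [])) (pair-triangle a b)
      (ev-app2 (ev-app1 (ev-app2 ev-proj ev-proj (ev-add a b)) (ev-triangle (a + b))) ev-proj (ev-add _ b))

    ev-triple : ∀ n x l → Eval X tripleC (n ∷ x ∷ l ∷ []) (triple n x l)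
    ev-triple n x l = ev-app2 ev-proj (ev-app2 ev-proj ev-proj (ev-pair x l)) (ev-pair n _)

module Pairing where

  open Programs
  open import Data.Nat using (zero; suc; _+_; _≤_; _<_; z≤n; s≤s)
  import Data.Nat.Properties as ℕP
  open import Data.Product using (_×_; _,_)
  open import Data.Sum using (inj₁; inj₂)
  open import Data.Empty using (⊥-elim)
  open import Relation.Binary.PropositionalEquality
  open import Relation.Binary.Definitions using (tri<; tri≈; tri>)

  triangle-mono : ∀ {s t} → s ≤ t → triangle s ≤ triangle t
  triangle-mono {s} {zero} z≤n = ℕP.≤-refl
  triangle-mono {s} {suc t} s≤t with ℕP.m≤n⇒m<n∨m≡n s≤t
  ... | inj₂ refl = ℕP.≤-refl
  ... | inj₁ (s≤s s≤t') = ℕP.≤-trans (triangle-mono s≤t') (ℕP.m≤m+n (triangle t) (suc t))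

  -- Pairs on a lower diagonal a + b = s are coded below every pair on a
  -- higher diagonal, since triangle s + b < triangle (suc s) for b ≤ s.
  pair-diagonal-< : ∀ a b a' b' → a + b < a' + b' → pair a b < pair a' b'
  pair-diagonal-< a b a' b' lt = subst₂ _<_ (pair-triangle a b) (pair-triangle a' b')
    (ℕP.<-≤-trans (ℕP.+-monoʳ-< (triangle (a + b)) (s≤s (ℕP.m≤n+m b a)))
                  (ℕP.≤-trans (triangle-mono lt) (ℕP.m≤m+n _ b')))

  pair-injective : ∀ a b a' b' → pair a b ≡ pair a' b' → a ≡ a' × b ≡ b'
  pair-injective a b a' b' eq with ℕP.<-cmp (a + b) (a' + b')
  ... | tri< lt _ _ = ⊥-elim (ℕP.<-irrefl eq (pair-diagonal-< a b a' b' lt))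
  ... | tri> _ _ gt = ⊥-elim (ℕP.<-irrefl (sym eq) (pair-diagonal-< a' b' a b gt))
  ... | tri≈ _ same _ = a≡a' , b≡b'
    where
    b≡b' : b ≡ b'
    b≡b' = ℕP.+-cancelˡ-≡ (triangle (a + b)) b b'
      (trans (pair-triangle a b) (trans eq (trans (sym (pair-triangle a' b')) (cong (λ s → triangle s + b') (sym same)))))
    a≡a' : a ≡ a'
    a≡a' = ℕP.+-cancelʳ-≡ b a a' (trans same (cong (a' +_) (sym b≡b')))

  -- Both components are bounded by the code: a + b ≤ triangle (a + b).
  pair-≥-fst : ∀ a b → a ≤ pair a b
  pair-≥-fst a b = subst (a ≤_) (pair-triangle a b)
    (ℕP.≤-trans (ℕP.m≤m+n a b) (ℕP.≤-trans (n≤triangle (a + b)) (ℕP.m≤m+n _ b)))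
    where
    n≤triangle : ∀ n → n ≤ triangle n
    n≤triangle zero = z≤n
    n≤triangle (suc n) = ℕP.m≤n+m (suc n) (triangle n)

  pair-≥-snd : ∀ a b → b ≤ pair a b
  pair-≥-snd a b = subst (b ≤_) (pair-triangle a b) (ℕP.m≤n+m b _)

  triple-injective : ∀ n x l n' x' l' → triple n x l ≡ triple n' x' l' → n ≡ n' × x ≡ x' × l ≡ l'
  triple-injective n x l n' x' l' eq with pair-injective n (pair x l) n' (pair x' l') eq
  ... | refl , eq' with pair-injective x l x' l' eq'
  ... | refl , refl = refl , refl , refl

  triple-≥-fst : ∀ n x l → n ≤ triple n x l
  triple-≥-fst n x l = pair-≥-fst n (pair x l)

  triple-≥-last : ∀ n x l → l ≤ triple n x l
  triple-≥-last n x l = ℕP.≤-trans (pair-≥-snd x l) (pair-≥-snd n (pair x l))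

module Clock where

  open Programs using (ifZero)
  open import Data.Nat as ℕ using (ℕ; zero; suc; _≤_; _<_; s≤s; _⊔_)
  import Data.Nat.Properties as ℕP
  open import Data.Bool using (Bool; true; false)
  open import Data.Vec using (Vec; []; _∷_; lookup; map)
  open import Data.Product using (Σ; ∃; _×_; _,_; proj₁; proj₂)
  open import Data.Sum using (inj₁; inj₂)
  open import Relation.Binary.PropositionalEquality

  bit : Bool → ℕ
  bit true = 1
  bit false = 0

  -- A stage-bounded computation returns 0 for "no value yet" and suc v
  -- for "value v".  guard rs x is x when every result in rs is a value,
  -- and 0 otherwise.
  guard : ∀ {m} → Vec ℕ m → ℕ → ℕ
  guard [] x = x
  guard (r ∷ rs) x = ifZero r 0 (guard rs x)

  -- Stage-bounded primitive recursion; s n r continues from value r.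
  iterate : ℕ → (ℕ → ℕ → ℕ) → ℕ → ℕ
  iterate b s zero = b
  iterate b s (suc n) = ifZero (iterate b s n) 0 (s n (ℕ.pred (iterate b s n)))

  -- Stage-bounded minimisation scans 0,…,l-1 with state 0 (searching),
  -- 1 (stuck on an undefined argument) or suc (suc y) (found y).
  scanStep : ℕ → ℕ → ℕ
  scanStep r j = ifZero r 1 (ifZero (ℕ.pred r) (suc (suc j)) 0)

  scan : (ℕ → ℕ) → ℕ → ℕ
  scan r zero = 0
  scan r (suc j) = ifZero (scan r j) (scanStep (r j) j) (scan r j)

  NonzeroBelow : (ℕ → ℕ) → ℕ → Set
  NonzeroBelow r y = ∀ z → z < y → ∃ λ w → r z ≡ suc (suc w)

  guard-values : ∀ {m} (rs : Vec ℕ m) x v → guard rs x ≡ suc v →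
    Σ (Vec ℕ m) (λ ys → rs ≡ map suc ys) × x ≡ suc v
  guard-values [] x v eq = ([] , refl) , eq
  guard-values (suc r ∷ rs) x v eq with guard-values rs x v eq
  ... | (ys , refl) , eq' = (r ∷ ys , refl) , eq'

  guard-all-values : ∀ {m} (ys : Vec ℕ m) x → guard (map suc ys) x ≡ x
  guard-all-values [] x = refl
  guard-all-values (y ∷ ys) x = guard-all-values ys x

  pred-suc : ∀ {m} (ys : Vec ℕ m) → map ℕ.pred (map suc ys) ≡ ys
  pred-suc [] = refl
  pred-suc (y ∷ ys) = cong (y ∷_) (pred-suc ys)

  scan-searching : ∀ r j → scan r j ≡ 0 → NonzeroBelow r j
  scan-searching r (suc j) eq z z<j with scan r j in eqj
  scan-searching r (suc j) eq z z<j | zero with r j in eqr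
  scan-searching r (suc j) () z z<j | zero | zero
  scan-searching r (suc j) () z z<j | zero | suc zero
  scan-searching r (suc j) eq z z<j | zero | suc (suc w) with ℕP.m≤n⇒m<n∨m≡n (ℕP.≤-pred z<j)
  ... | inj₁ z<j' = scan-searching r j eqj z z<j'
  ... | inj₂ refl = w , eqr
  scan-searching r (suc j) () z z<j | suc _

  searching-scan : ∀ r j → NonzeroBelow r j → scan r j ≡ 0
  searching-scan r zero below = refl
  searching-scan r (suc j) below
    rewrite searching-scan r j (λ z z<j → below z (ℕP.m≤n⇒m≤1+n z<j)) with below j ℕP.≤-refl
  ... | w , eq rewrite eq = refl

  scan-found : ∀ r j y → scan r j ≡ suc (suc y) → y < j × r y ≡ 1 × NonzeroBelow r y
  scan-found r (suc j) y eq with scan r j in eqj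
  scan-found r (suc j) y eq | zero with r j in eqr
  scan-found r (suc j) y () | zero | zero
  scan-found r (suc j) .j refl | zero | suc zero = ℕP.≤-refl , eqr , scan-searching r j eqj
  scan-found r (suc j) y () | zero | suc (suc w)
  scan-found r (suc j) y refl | suc _ with scan-found r j y eqj
  ... | y<j , ry , below = ℕP.m≤n⇒m≤1+n y<j , ry , below

  found-scan : ∀ r j y → y < j → r y ≡ 1 → NonzeroBelow r y → scan r j ≡ suc (suc y)
  found-scan r (suc j) y (s≤s y≤j) ry below with ℕP.m≤n⇒m<n∨m≡n y≤j
  ... | inj₂ refl rewrite searching-scan r y below | ry = refl
  ... | inj₁ y<j rewrite found-scan r j y y<j ry below = refl

  bound-below : ∀ y (F : ∀ z → z < y → ℕ) → ∃ λ L → ∀ z (z<y : z < y) → F z z<y ≤ L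
  bound-below zero F = 0 , λ z ()
  bound-below (suc y) F with bound-below y (λ z z<y → F z (ℕP.m≤n⇒m≤1+n z<y))
  ... | L , bounded = L ⊔ F y ℕP.≤-refl , below
    where
    below : ∀ z (z<y : z < suc y) → F z z<y ≤ L ⊔ F y ℕP.≤-refl
    below z z<y with ℕP.m≤n⇒m<n∨m≡n (ℕP.≤-pred z<y)
    ... | inj₁ z<y' = ℕP.≤-trans (subst (λ q → F z q ≤ L) (ℕP.≤-irrelevant _ z<y) (bounded z z<y'))
                                (ℕP.m≤m⊔n L _)
    ... | inj₂ refl = subst (λ q → F z q ≤ L ⊔ F y ℕP.≤-refl) (ℕP.≤-irrelevant _ z<y) (ℕP.m≤n⊔m L _)

  module _ (X : ℕ → Bool) where
    -- clocked X φ l xs runs φ^X(xs) with every minimisation searching only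
    -- below the stage l.
    mutual
      clocked : ∀ {k} → Code k → ℕ → Vec ℕ k → ℕ
      clocked zer l xs = 1
      clocked succ l (x ∷ []) = suc (suc x)
      clocked (proj i) l xs = suc (lookup xs i)
      clocked (comp f gs) l xs = guard (clockedAll gs l xs) (clocked f l (map ℕ.pred (clockedAll gs l xs)))
      clocked (prec f g) l (n ∷ xs) = iterate (clocked f l xs) (λ m r → clocked g l (m ∷ r ∷ xs)) n
      clocked (mu f) l xs = ℕ.pred (scan (λ y → clocked f l (y ∷ xs)) l)
      clocked oracle l (x ∷ []) = suc (bit (X x))

      clockedAll : ∀ {k m} → Vec (Code k) m → ℕ → Vec ℕ k → Vec ℕ m
      clockedAll [] l xs = []
      clockedAll (g ∷ gs) l xs = clocked g l xs ∷ clockedAll gs l xs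

    ev-oracle : ∀ x → Eval X oracle (x ∷ []) (bit (X x))
    ev-oracle x with X x in eq
    ... | true = ev-orc-t eq
    ... | false = ev-orc-f eq

    ∷-injective : ∀ {m} {a b : ℕ} {as bs : Vec ℕ m} → a ∷ as ≡ b ∷ bs → a ≡ b × as ≡ bs
    ∷-injective refl = refl , refl

    mutual
      clocked-sound : ∀ {k} (φ : Code k) l xs v → clocked φ l xs ≡ suc v → Eval X φ xs v
      clocked-sound zer l xs .0 refl = ev-zer
      clocked-sound succ l (x ∷ []) .(suc x) refl = ev-succ
      clocked-sound (proj i) l xs .(lookup xs i) refl = ev-proj
      clocked-sound (comp f gs) l xs v eq with guard-values (clockedAll gs l xs) _ v eq
      ... | (ys , eqs) , eq' rewrite eqs | pred-suc ys =
        ev-comp (clockedAll-sound gs l xs ys eqs) (clocked-sound f l ys v eq')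
      clocked-sound (prec f g) l (n ∷ xs) v eq = iterate-sound f g l xs n v eq
      clocked-sound (mu f) l xs v eq with scan (λ y → clocked f l (y ∷ xs)) l in eqs
      clocked-sound (mu f) l xs v () | zero
      clocked-sound (mu f) l xs v () | suc zero
      clocked-sound (mu f) l xs .y refl | suc (suc y) with scan-found (λ y → clocked f l (y ∷ xs)) l y eqs
      ... | _ , fy , below = ev-mu (clocked-sound f l (y ∷ xs) 0 fy)
              (λ z z<y → proj₁ (below z z<y) , clocked-sound f l (z ∷ xs) _ (proj₂ (below z z<y)))
      clocked-sound oracle l (x ∷ []) .(bit (X x)) refl = ev-oracle x

      clockedAll-sound : ∀ {k m} (gs : Vec (Code k) m) l xs ys →
        clockedAll gs l xs ≡ map suc ys → EvalAll X gs xs ys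
      clockedAll-sound [] l xs [] eq = ea-nil
      clockedAll-sound (g ∷ gs) l xs (y ∷ ys) eq with ∷-injective eq
      ... | eq₁ , eq₂ = ea-cons (clocked-sound g l xs y eq₁) (clockedAll-sound gs l xs ys eq₂)

      iterate-sound : ∀ {k} (f : Code k) g l xs n v →
        iterate (clocked f l xs) (λ m r → clocked g l (m ∷ r ∷ xs)) n ≡ suc v → Eval X (prec f g) (n ∷ xs) v
      iterate-sound f g l xs zero v eq = ev-prec-z (clocked-sound f l xs v eq)
      iterate-sound f g l xs (suc n) v eq with iterate (clocked f l xs) (λ m r → clocked g l (m ∷ r ∷ xs)) n in eqn
      iterate-sound f g l xs (suc n) v () | zero
      ... | suc r = ev-prec-s (iterate-sound f g l xs n r eqn) (clocked-sound g l (n ∷ r ∷ xs) v eq)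

    mutual
      clocked-mono : ∀ {k} (φ : Code k) {l l'} xs v → l ≤ l' → clocked φ l xs ≡ suc v → clocked φ l' xs ≡ suc v
      clocked-mono zer xs v l≤l' eq = eq
      clocked-mono succ (x ∷ []) v l≤l' eq = eq
      clocked-mono (proj i) xs v l≤l' eq = eq
      clocked-mono (comp f gs) {l} {l'} xs v l≤l' eq with guard-values (clockedAll gs l xs) _ v eq
      ... | (ys , eqs) , eq' rewrite eqs | pred-suc ys | clockedAll-mono gs xs ys l≤l' eqs
                                  | pred-suc ys | guard-all-values ys (clocked f l' ys) = clocked-mono f ys v l≤l' eq'
      clocked-mono (prec f g) (n ∷ xs) v l≤l' eq = iterate-mono f g xs n v l≤l' eq
      clocked-mono (mu f) {l} xs v l≤l' eq with scan (λ y → clocked f l (y ∷ xs)) l in eqs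
      clocked-mono (mu f) xs v l≤l' () | zero
      clocked-mono (mu f) xs v l≤l' () | suc zero
      clocked-mono (mu f) {l} {l'} xs .y l≤l' refl | suc (suc y)
        with scan-found (λ y → clocked f l (y ∷ xs)) l y eqs
      ... | y<l , fy , below
        rewrite found-scan (λ y → clocked f l' (y ∷ xs)) l' y (ℕP.<-≤-trans y<l l≤l')
                  (clocked-mono f (y ∷ xs) 0 l≤l' fy)
                  (λ z z<y → proj₁ (below z z<y) , clocked-mono f (z ∷ xs) _ l≤l' (proj₂ (below z z<y))) = refl
      clocked-mono oracle (x ∷ []) v l≤l' eq = eq

      clockedAll-mono : ∀ {k m} (gs : Vec (Code k) m) {l l'} xs ys → l ≤ l' →
        clockedAll gs l xs ≡ map suc ys → clockedAll gs l' xs ≡ map suc ys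
      clockedAll-mono [] xs [] l≤l' eq = refl
      clockedAll-mono (g ∷ gs) xs (y ∷ ys) l≤l' eq with ∷-injective eq
      ... | eq₁ , eq₂ = cong₂ _∷_ (clocked-mono g xs y l≤l' eq₁) (clockedAll-mono gs xs ys l≤l' eq₂)

      iterate-mono : ∀ {k} (f : Code k) g {l l'} xs n v → l ≤ l' →
        iterate (clocked f l xs) (λ m r → clocked g l (m ∷ r ∷ xs)) n ≡ suc v →
        iterate (clocked f l' xs) (λ m r → clocked g l' (m ∷ r ∷ xs)) n ≡ suc v
      iterate-mono f g xs zero v l≤l' eq = clocked-mono f xs v l≤l' eq
      iterate-mono f g {l} xs (suc n) v l≤l' eq with iterate (clocked f l xs) (λ m r → clocked g l (m ∷ r ∷ xs)) n in eqn
      iterate-mono f g xs (suc n) v l≤l' () | zero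
      ... | suc r rewrite iterate-mono f g xs n r l≤l' eqn = clocked-mono g (n ∷ r ∷ xs) v l≤l' eq

    mutual
      clocked-complete : ∀ {k} {φ : Code k} {xs v} → Eval X φ xs v → ∃ λ l → clocked φ l xs ≡ suc v
      clocked-complete ev-zer = 0 , refl
      clocked-complete ev-succ = 0 , refl
      clocked-complete ev-proj = 0 , refl
      clocked-complete (ev-comp {f = f} {gs = gs} {xs = xs} {ys = ys} {v = v} es e)
        with clockedAll-complete es | clocked-complete e
      ... | l₁ , eq₁ | l₂ , eq₂ = l₁ ⊔ l₂ , at-join
        where
        at-join : clocked (comp f gs) (l₁ ⊔ l₂) xs ≡ suc v
        at-join rewrite clockedAll-mono gs xs ys (ℕP.m≤m⊔n l₁ l₂) eq₁ | pred-suc ys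
                      | guard-all-values ys (clocked f (l₁ ⊔ l₂) ys) =
          clocked-mono f ys v (ℕP.m≤n⊔m l₁ l₂) eq₂
      clocked-complete (ev-prec-z e) = clocked-complete e
      clocked-complete (ev-prec-s {f = f} {g = g} {n = n} {xs = xs} {r = r} {v = v} e₁ e₂)
        with clocked-complete e₁ | clocked-complete e₂
      ... | l₁ , eq₁ | l₂ , eq₂ = l₁ ⊔ l₂ , at-join
        where
        at-join : clocked (prec f g) (l₁ ⊔ l₂) (suc n ∷ xs) ≡ suc v
        at-join rewrite clocked-mono (prec f g) (n ∷ xs) r (ℕP.m≤m⊔n l₁ l₂) eq₁ =
          clocked-mono g (n ∷ r ∷ xs) v (ℕP.m≤n⊔m l₁ l₂) eq₂
      clocked-complete (ev-mu e below) = mu-complete e below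
      clocked-complete (ev-orc-t p) = 0 , cong (λ b → suc (bit b)) p
      clocked-complete (ev-orc-f p) = 0 , cong (λ b → suc (bit b)) p

      -- The stage must exceed y and the stages of all arguments below y.
      mu-complete : ∀ {k} {f : Code (suc k)} {xs y} → Eval X f (y ∷ xs) 0 →
        (∀ z → z < y → Σ ℕ λ w → Eval X f (z ∷ xs) (suc w)) → ∃ λ l → clocked (mu f) l xs ≡ suc y
      mu-complete {f = f} {xs} {y} e below
        with clocked-complete e | bound-below y (λ z z<y → proj₁ (clocked-complete (proj₂ (below z z<y))))
      ... | l₀ , eq₀ | L , bounded = l , at-l
        where
        l : ℕ
        l = (L ⊔ l₀) ⊔ suc y
        L≤l : L ≤ l
        L≤l = ℕP.≤-trans (ℕP.m≤m⊔n L l₀) (ℕP.m≤m⊔n _ _)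
        at-l : clocked (mu f) l xs ≡ suc y
        at-l rewrite found-scan (λ z → clocked f l (z ∷ xs)) l y (ℕP.m≤n⊔m _ (suc y))
            (clocked-mono f (y ∷ xs) 0 (ℕP.≤-trans (ℕP.m≤n⊔m L l₀) (ℕP.m≤m⊔n _ _)) eq₀)
            (λ z z<y → proj₁ (below z z<y) , clocked-mono f (z ∷ xs) _
                 (ℕP.≤-trans (bounded z z<y) L≤l) (proj₂ (clocked-complete (proj₂ (below z z<y))))) = refl

      clockedAll-complete : ∀ {k m} {gs : Vec (Code k) m} {xs ys} → EvalAll X gs xs ys →
        ∃ λ l → clockedAll gs l xs ≡ map suc ys
      clockedAll-complete ea-nil = 0 , refl
      clockedAll-complete (ea-cons {g = g} {gs = gs} {xs = xs} {v = v} {vs = vs} e es)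
        with clocked-complete e | clockedAll-complete es
      ... | l₁ , eq₁ | l₂ , eq₂ = l₁ ⊔ l₂ , cong₂ _∷_ (clocked-mono g xs v (ℕP.m≤m⊔n l₁ l₂) eq₁)
                                                     (clockedAll-mono gs xs vs (ℕP.m≤n⊔m l₁ l₂) eq₂)

module ClockProgram where

  open Programs
  open Clock
  open import Data.Nat as ℕ using (ℕ; zero; suc)
  open import Data.Bool using (Bool)
  open import Data.Vec using (Vec; []; _∷_; lookup; map; tabulate)
  open import Data.Vec.Properties using (tabulate∘lookup)
  open import Data.Fin using (Fin; zero; suc)
  open import Relation.Binary.PropositionalEquality using (subst)

  drop1 : ∀ {k} → Vec (Code (suc k)) k
  drop1 = tabulate (λ i → proj (suc i))

  drop2 : ∀ {k} → Vec (Code (suc (suc k))) k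
  drop2 = tabulate (λ i → proj (suc (suc i)))

  drop3 : ∀ {k} → Vec (Code (suc (suc (suc k)))) k
  drop3 = tabulate (λ i → proj (suc (suc (suc i))))

  guardC : ∀ {n m} → Vec (Code n) m → Code n → Code n
  guardC [] c = c
  guardC (g ∷ gs) c = app3 ifZeroC g zer (guardC gs c)

  scanStepC : ∀ {k} → Code (suc k) → Code (suc k)
  scanStepC r = app3 ifZeroC r oneC (app3 ifZeroC (app1 predC r) (app1 succ (app1 succ #0)) zer)

  -- The stage-bounded interpreter is itself computable: clockedC φ takes
  -- the stage as an extra first argument and computes clocked X φ, by
  -- recursion on φ following the clauses of clocked.
  mutual
    clockedC : ∀ {k} → Code k → Code (suc k)
    clockedC zer = oneC
    clockedC succ = app1 succ (app1 succ #1)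
    clockedC (proj i) = app1 succ (proj (suc i))
    clockedC (comp f gs) = guardC (clockedAllC gs) (comp (clockedC f) (#0 ∷ map (app1 predC) (clockedAllC gs)))
    clockedC (prec f g) = comp (iterateC f g) (#1 ∷ #0 ∷ drop2)
    clockedC (mu f) = app1 predC (comp (scanC f) (#0 ∷ #0 ∷ drop1))
    clockedC oracle = app1 succ (app1 oracle #1)

    clockedAllC : ∀ {k m} → Vec (Code k) m → Vec (Code (suc k)) m
    clockedAllC [] = []
    clockedAllC (g ∷ gs) = clockedC g ∷ clockedAllC gs

    -- Arguments: counter, stage, inputs.
    iterateC : ∀ {k} → Code k → Code (suc (suc k)) → Code (suc (suc k))
    iterateC f g = prec (clockedC f) (app3 ifZeroC #1 zer (comp (clockedC g) (#2 ∷ #0 ∷ app1 predC #1 ∷ drop3)))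

    -- Arguments: position j, state, stage, inputs; computes f at stage on j.
    scanArgC : ∀ {k} → Code (suc k) → Code (suc (suc (suc k)))
    scanArgC f = comp (clockedC f) (#2 ∷ #0 ∷ drop3)

    -- Arguments: scan length, stage, inputs.
    scanC : ∀ {k} → Code (suc k) → Code (suc (suc k))
    scanC f = prec zer (app3 ifZeroC #1 (scanStepC (scanArgC f)) #1)

  module _ {X : ℕ → Bool} where
    ev-projs : ∀ {k n} (ρ : Fin k → Fin n) ys →
      EvalAll X (tabulate (λ i → proj (ρ i))) ys (tabulate (λ i → lookup ys (ρ i)))
    ev-projs {zero} ρ ys = ea-nil
    ev-projs {suc k} ρ ys = ea-cons ev-proj (ev-projs (λ i → ρ (suc i)) ys)

    ev-drop1 : ∀ {k} a (xs : Vec ℕ k) → EvalAll X drop1 (a ∷ xs) xs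
    ev-drop1 a xs = subst (EvalAll X drop1 (a ∷ xs)) (tabulate∘lookup xs) (ev-projs suc (a ∷ xs))

    ev-drop2 : ∀ {k} a b (xs : Vec ℕ k) → EvalAll X drop2 (a ∷ b ∷ xs) xs
    ev-drop2 a b xs = subst (EvalAll X drop2 (a ∷ b ∷ xs)) (tabulate∘lookup xs)
      (ev-projs (λ i → suc (suc i)) (a ∷ b ∷ xs))

    ev-drop3 : ∀ {k} a b c (xs : Vec ℕ k) → EvalAll X drop3 (a ∷ b ∷ c ∷ xs) xs
    ev-drop3 a b c xs = subst (EvalAll X drop3 (a ∷ b ∷ c ∷ xs)) (tabulate∘lookup xs)
      (ev-projs (λ i → suc (suc (suc i))) (a ∷ b ∷ c ∷ xs))

    ev-guard : ∀ {n m} {gs : Vec (Code n) m} {c xs rs v} → EvalAll X gs xs rs → Eval X c xs v →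
      Eval X (guardC gs c) xs (guard rs v)
    ev-guard ea-nil e = e
    ev-guard (ea-cons {v = r} eg es) e = ev-app3 eg ev-zer (ev-guard es e) (ev-ifZero r 0 _)

    ev-map-pred : ∀ {n m} {gs : Vec (Code n) m} {xs rs} → EvalAll X gs xs rs →
      EvalAll X (map (app1 predC) gs) xs (map ℕ.pred rs)
    ev-map-pred ea-nil = ea-nil
    ev-map-pred (ea-cons {v = r} e es) = ea-cons (ev-app1 e (ev-pred r)) (ev-map-pred es)

    mutual
      ev-clocked : ∀ {k} (φ : Code k) l xs → Eval X (clockedC φ) (l ∷ xs) (clocked X φ l xs)
      ev-clocked zer l xs = ev-one
      ev-clocked succ l (x ∷ []) = ev-app1 (ev-app1 ev-proj ev-succ) ev-succ
      ev-clocked (proj i) l xs = ev-app1 ev-proj ev-succ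
      ev-clocked (comp f gs) l xs = ev-guard (ev-clockedAll gs l xs)
        (ev-comp (ea-cons ev-proj (ev-map-pred (ev-clockedAll gs l xs))) (ev-clocked f l _))
      ev-clocked (prec f g) l (n ∷ xs) =
        ev-comp (ea-cons ev-proj (ea-cons ev-proj (ev-drop2 l n xs))) (ev-iterate f g l xs n)
      ev-clocked (mu f) l xs =
        ev-app1 (ev-comp (ea-cons ev-proj (ea-cons ev-proj (ev-drop1 l xs))) (ev-scan f l xs l)) (ev-pred _)
      ev-clocked oracle l (x ∷ []) = ev-app1 (ev-app1 ev-proj (ev-oracle X x)) ev-succ

      ev-clockedAll : ∀ {k m} (gs : Vec (Code k) m) l xs → EvalAll X (clockedAllC gs) (l ∷ xs) (clockedAll X gs l xs)
      ev-clockedAll [] l xs = ea-nil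
      ev-clockedAll (g ∷ gs) l xs = ea-cons (ev-clocked g l xs) (ev-clockedAll gs l xs)

      ev-iterate : ∀ {k} (f : Code k) g l xs n →
        Eval X (iterateC f g) (n ∷ l ∷ xs) (iterate (clocked X f l xs) (λ m r → clocked X g l (m ∷ r ∷ xs)) n)
      ev-iterate f g l xs zero = ev-prec-z (ev-clocked f l xs)
      ev-iterate f g l xs (suc n) = ev-prec-s (ev-iterate f g l xs n)
        (ev-app3 ev-proj ev-zer
          (ev-comp (ea-cons ev-proj (ea-cons ev-proj (ea-cons (ev-app1 ev-proj (ev-pred r)) (ev-drop3 n r l xs))))
             (ev-clocked g l (n ∷ ℕ.pred r ∷ xs)))
          (ev-ifZero r 0 _))
        where
        r : ℕ
        r = iterate (clocked X f l xs) (λ m r → clocked X g l (m ∷ r ∷ xs)) n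

      ev-scan : ∀ {k} (f : Code (suc k)) l xs j → Eval X (scanC f) (j ∷ l ∷ xs) (scan (λ y → clocked X f l (y ∷ xs)) j)
      ev-scan f l xs zero = ev-prec-z ev-zer
      ev-scan f l xs (suc j) = ev-prec-s (ev-scan f l xs j)
        (ev-app3 ev-proj
          (ev-app3 ev-arg ev-one
            (ev-app3 (ev-app1 ev-arg (ev-pred r)) (ev-app1 (ev-app1 ev-proj ev-succ) ev-succ) ev-zer (ev-ifZero (ℕ.pred r) _ 0))
            (ev-ifZero r 1 _))
          ev-proj (ev-ifZero s _ s))
        where
        s r : ℕ
        s = scan (λ y → clocked X f l (y ∷ xs)) j
        r = clocked X f l (j ∷ xs)
        ev-arg : Eval X (scanArgC f) (j ∷ s ∷ l ∷ xs) r
        ev-arg = ev-comp (ea-cons ev-proj (ea-cons ev-proj (ev-drop3 j s l xs))) (ev-clocked f l (j ∷ xs))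

module Relativization where

  open Programs
  open Clock using (bit)
  open import Data.Nat using (ℕ)
  open import Data.Bool using (Bool; true; false)
  open import Data.Vec using (Vec; []; _∷_)
  open import Data.Product using (_,_; proj₁; proj₂)
  open import Relation.Binary.PropositionalEquality

  mutual
    relativize : ∀ {k} → Code k → Code 1 → Code k
    relativize zer g = zer
    relativize succ g = succ
    relativize (proj i) g = proj i
    relativize (comp f fs) g = comp (relativize f g) (relativizeAll fs g)
    relativize (prec f h) g = prec (relativize f g) (relativize h g)
    relativize (mu f) g = mu (relativize f g)
    relativize oracle g = g

    relativizeAll : ∀ {k m} → Vec (Code k) m → Code 1 → Vec (Code k) m
    relativizeAll [] g = []
    relativizeAll (f ∷ fs) g = relativize f g ∷ relativizeAll fs g

  module _ {X Y : ℕ → Bool} {g : Code 1} (g-computes-Y : ∀ q → Eval X g (q ∷ []) (bit (Y q))) where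
    mutual
      relativize-complete : ∀ {k} {φ : Code k} {xs v} → Eval Y φ xs v → Eval X (relativize φ g) xs v
      relativize-complete ev-zer = ev-zer
      relativize-complete ev-succ = ev-succ
      relativize-complete ev-proj = ev-proj
      relativize-complete (ev-comp es e) = ev-comp (relativizeAll-complete es) (relativize-complete e)
      relativize-complete (ev-prec-z e) = ev-prec-z (relativize-complete e)
      relativize-complete (ev-prec-s e₁ e₂) = ev-prec-s (relativize-complete e₁) (relativize-complete e₂)
      relativize-complete (ev-mu e below) =
        ev-mu (relativize-complete e) (λ z z<y → proj₁ (below z z<y) , relativize-complete (proj₂ (below z z<y)))
      relativize-complete (ev-orc-t {x = x} p) = subst (λ b → Eval X g (x ∷ []) (bit b)) p (g-computes-Y x)
      relativize-complete (ev-orc-f {x = x} p) = subst (λ b → Eval X g (x ∷ []) (bit b)) p (g-computes-Y x)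

      relativizeAll-complete : ∀ {k m} {fs : Vec (Code k) m} {xs ys} →
        EvalAll Y fs xs ys → EvalAll X (relativizeAll fs g) xs ys
      relativizeAll-complete ea-nil = ea-nil
      relativizeAll-complete (ea-cons e es) = ea-cons (relativize-complete e) (relativizeAll-complete es)

    mutual
      relativize-sound : ∀ {k} (φ : Code k) {xs v} → Eval X (relativize φ g) xs v → Eval Y φ xs v
      relativize-sound zer ev-zer = ev-zer
      relativize-sound succ ev-succ = ev-succ
      relativize-sound (proj i) ev-proj = ev-proj
      relativize-sound (comp f fs) (ev-comp es e) = ev-comp (relativizeAll-sound fs es) (relativize-sound f e)
      relativize-sound (prec f h) (ev-prec-z e) = ev-prec-z (relativize-sound f e)
      relativize-sound (prec f h) (ev-prec-s e₁ e₂) = ev-prec-s (relativize-sound (prec f h) e₁) (relativize-sound h e₂)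
      relativize-sound (mu f) (ev-mu e below) =
        ev-mu (relativize-sound f e) (λ z z<y → proj₁ (below z z<y) , relativize-sound f (proj₂ (below z z<y)))
      relativize-sound oracle {x ∷ []} e with eval-functional e (g-computes-Y x)
      ... | refl with Y x in eq
      ... | true = ev-orc-t eq
      ... | false = ev-orc-f eq

      relativizeAll-sound : ∀ {k m} (fs : Vec (Code k) m) {xs ys} →
        EvalAll X (relativizeAll fs g) xs ys → EvalAll Y fs xs ys
      relativizeAll-sound [] ea-nil = ea-nil
      relativizeAll-sound (f ∷ fs) (ea-cons e es) = ea-cons (relativize-sound f e) (relativizeAll-sound fs es)

module PositiveStages where

  open Programs
  open Pairing
  open Clock
  open ClockProgram
  open import Data.Nat using (ℕ; zero; suc; _+_; _<_; s≤s)
  import Data.Nat.Properties as ℕP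
  open import Data.Bool using (Bool; true; false)
  open import Data.Vec using (Vec; []; _∷_)
  open import Data.Product using (∃; _×_; _,_)
  open import Data.Sum using (inj₁; inj₂)
  open import Relation.Binary.PropositionalEquality

  sumBelow : (ℕ → ℕ) → ℕ → ℕ
  sumBelow F zero = 0
  sumBelow F (suc j) = sumBelow F j + F j

  positive-term : ∀ F j {s} → sumBelow F j ≡ suc s → ∃ λ i → i < j × ∃ λ w → F i ≡ suc w
  positive-term F (suc j) {s} eq with sumBelow F j in eqj
  ... | zero = j , ℕP.≤-refl , s , eq
  ... | suc s' with positive-term F j eqj
  ...   | i , i<j , w , Fi = i , ℕP.m≤n⇒m≤1+n i<j , w , Fi

  positive-sum : ∀ F j i {w} → i < j → F i ≡ suc w → ∃ λ s → sumBelow F j ≡ suc s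
  positive-sum F (suc j) i {w} (s≤s i≤j) Fi with ℕP.m≤n⇒m<n∨m≡n i≤j
  ... | inj₂ refl rewrite Fi = sumBelow F i + w , ℕP.+-suc _ w
  ... | inj₁ i<j with positive-sum F j i i<j Fi
  ...   | s , eq rewrite eq = s + F j , refl

  boundedSumC : ∀ {k} → Code (suc k) → Code (suc k)
  boundedSumC f = prec zer (app2 addC #1 (comp f (#0 ∷ drop2)))

  ev-boundedSum : ∀ {X k} {f : Code (suc k)} {xs : Vec ℕ k} {F : ℕ → ℕ} →
    (∀ i → Eval X f (i ∷ xs) (F i)) → ∀ j → Eval X (boundedSumC f) (j ∷ xs) (sumBelow F j)
  ev-boundedSum ev-f zero = ev-prec-z ev-zer
  ev-boundedSum {xs = xs} {F} ev-f (suc j) = ev-prec-s (ev-boundedSum ev-f j)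
    (ev-app2 ev-proj (ev-comp (ea-cons ev-proj (ev-drop2 j (sumBelow F j) xs)) (ev-f j)) (ev-add _ _))

  isPositive : ℕ → Bool
  isPositive zero = false
  isPositive (suc _) = true

  -- The positive stages of φ: the oracle holding ⟨n,1,l⟩ exactly when
  -- φ^X(n) is found to equal 1 at stage l.  Since n, l ≤ ⟨n,1,l⟩, it is
  -- decided by a double bounded search over n, l ≤ q.
  module _ (φ : Code 1) where
    -- Arguments l, n, q: is q = ⟨n,1,l⟩ with φ(n) = 1 at stage l?
    matchC : Code 3
    matchC = app3 ifZeroC (app2 isEqualC (app3 tripleC #1 oneC #0) #2) zer
                  (app2 isEqualC (comp (clockedC φ) (#0 ∷ #1 ∷ [])) (app1 succ oneC))

    -- Arguments n, q.
    matchesForC : Code 2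
    matchesForC = comp (boundedSumC matchC) (app1 succ #1 ∷ #0 ∷ #1 ∷ [])

    positiveStagesC : Code 1
    positiveStagesC = app3 ifZeroC (comp (boundedSumC matchesForC) (app1 succ #0 ∷ #0 ∷ [])) zer oneC

  module _ (X : ℕ → Bool) (φ : Code 1) where
    match : ℕ → ℕ → ℕ → ℕ
    match l n q = ifZero (isEqual (triple n 1 l) q) 0 (isEqual (clocked X φ l (n ∷ [])) 2)

    matchesFor : ℕ → ℕ → ℕ
    matchesFor n q = sumBelow (λ l → match l n q) (suc q)

    matches : ℕ → ℕ
    matches q = sumBelow (λ n → matchesFor n q) (suc q)

    positiveStages : ℕ → Bool
    positiveStages q = isPositive (matches q)

    ev-positiveStages : ∀ q → Eval X (positiveStagesC φ) (q ∷ []) (bit (positiveStages q))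
    ev-positiveStages q = subst (Eval X (positiveStagesC φ) (q ∷ [])) (ifZero-bit (matches q))
      (ev-app3 (ev-comp (ea-cons (ev-app1 ev-proj ev-succ) (ea-cons ev-proj ea-nil))
                        (ev-boundedSum ev-matchesFor (suc q)))
               ev-zer ev-one (ev-ifZero _ 0 1))
      where
      ifZero-bit : ∀ s → ifZero s 0 1 ≡ bit (isPositive s)
      ifZero-bit zero = refl
      ifZero-bit (suc s) = refl
      ev-match : ∀ n l → Eval X (matchC φ) (l ∷ n ∷ q ∷ []) (match l n q)
      ev-match n l = ev-app3 (ev-app2 (ev-app3 ev-proj ev-one ev-proj (ev-triple n 1 l)) ev-proj (ev-isEqual _ q))
        ev-zer
        (ev-app2 (ev-comp (ea-cons ev-proj (ea-cons ev-proj ea-nil)) (ev-clocked φ l (n ∷ [])))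
                 (ev-app1 ev-one ev-succ) (ev-isEqual _ 2))
        (ev-ifZero _ 0 _)
      ev-matchesFor : ∀ n → Eval X (matchesForC φ) (n ∷ q ∷ []) (matchesFor n q)
      ev-matchesFor n = ev-comp (ea-cons (ev-app1 ev-proj ev-succ) (ea-cons ev-proj (ea-cons ev-proj ea-nil)))
        (ev-boundedSum (ev-match n) (suc q))

    positiveStages-sound : ∀ q → positiveStages q ≡ true →
      ∃ λ n → ∃ λ l → q ≡ triple n 1 l × clocked X φ l (n ∷ []) ≡ 2
    positiveStages-sound q holds with matches q in eq
    ... | suc _ with positive-term _ (suc q) eq
    ... | n , _ , _ , eqn with positive-term _ (suc q) eqn
    ... | l , _ , _ , eql with isEqual (triple n 1 l) q in same
    ... | suc _ = n , l , sym (isEqual-sound _ _ same) , isEqual-sound _ _ eql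

    positiveStages-complete : ∀ n l → clocked X φ l (n ∷ []) ≡ 2 → positiveStages (triple n 1 l) ≡ true
    positiveStages-complete n l found
      with positive-sum (λ l' → match l' n q) (suc q) l (s≤s (triple-≥-last n 1 l)) matched
      where
      q : ℕ
      q = triple n 1 l
      matched : match l n q ≡ 1
      matched rewrite isEqual-refl q | found = refl
    ... | s , eqn with positive-sum (λ n' → matchesFor n' (triple n 1 l)) (suc (triple n 1 l)) n
                         (s≤s (triple-≥-fst n 1 l)) eqn
    ... | _ , eq rewrite eq = refl

module Reductions where

  open Density
  open Programs
  open Pairing
  open Clock
  open Relativization
  open PositiveStages
  open import Data.Nat as ℕ using (ℕ; zero; suc; _<_)
  import Data.Nat.Properties as ℕP
  open import Data.Bool using (Bool; true; false; _∧_)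
  open import Data.Vec using ([]; _∷_)
  open import Data.Fin using (zero)
  open import Data.Product using (∃; _×_; _,_; proj₁; proj₂)
  open import Data.Sum using (_⊎_; inj₁; inj₂)
  open import Relation.Binary.PropositionalEquality

  LeastZero : (ℕ → ℕ) → Set
  LeastZero F = ∃ λ y → F y ≡ 0 × (∀ z → z < y → ∃ λ w → F z ≡ suc w)

  zero-below? : ∀ F j → LeastZero F ⊎ (∀ z → z < j → ∃ λ w → F z ≡ suc w)
  zero-below? F zero = inj₂ (λ z ())
  zero-below? F (suc j) with zero-below? F j
  ... | inj₁ least = inj₁ least
  ... | inj₂ positive with F j in eq
  ...   | zero = inj₁ (j , eq , positive)
  ...   | suc w = inj₂ positive'
    where
    positive' : ∀ z → z < suc j → ∃ λ w → F z ≡ suc w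
    positive' z z<j with ℕP.m≤n⇒m<n∨m≡n (ℕP.≤-pred z<j)
    ... | inj₁ z<j' = positive z z<j'
    ... | inj₂ refl = w , eq

  least-zero : ∀ F j → F j ≡ 0 → LeastZero F
  least-zero F j Fj with zero-below? F (suc j)
  ... | inj₁ least = least
  ... | inj₂ positive with positive j ℕP.≤-refl
  ... | _ , Fj' with trans (sym Fj) Fj'
  ... | ()

  -- Reading positive information: positiveInfoC on n searches for a stage
  -- l with ⟨n,1,l⟩ in the oracle and then answers 1.
  noPositiveInfoC : Code 2
  noPositiveInfoC = app3 ifZeroC (app1 oracle (app3 tripleC #1 oneC #0)) oneC zer

  positiveInfoC : Code 1
  positiveInfoC = app1 oneC (mu noPositiveInfoC)

  module _ {X : ℕ → Bool} where
    noPositiveInfo : ℕ → ℕ → ℕ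
    noPositiveInfo n l = ifZero (bit (X (triple n 1 l))) 1 0

    ev-noPositiveInfo : ∀ l n → Eval X noPositiveInfoC (l ∷ n ∷ []) (noPositiveInfo n l)
    ev-noPositiveInfo l n = ev-app3 (ev-app1 (ev-app3 ev-proj ev-one ev-proj (ev-triple n 1 l)) (ev-oracle X _))
                                    ev-one ev-zer (ev-ifZero _ 1 0)

    noPositiveInfo-zero : ∀ n l → X (triple n 1 l) ≡ true → noPositiveInfo n l ≡ 0
    noPositiveInfo-zero n l inX rewrite inX = refl

    zero-noPositiveInfo : ∀ n l → noPositiveInfo n l ≡ 0 → X (triple n 1 l) ≡ true
    zero-noPositiveInfo n l eq with X (triple n 1 l)
    ... | true = refl

    positiveInfo-halts : ∀ n l → X (triple n 1 l) ≡ true → Eval X positiveInfoC (n ∷ []) 1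
    positiveInfo-halts n l inX with least-zero (noPositiveInfo n) l (noPositiveInfo-zero n l inX)
    ... | y , zy , positive = ev-app1 (ev-mu (subst (Eval X noPositiveInfoC (y ∷ n ∷ [])) zy (ev-noPositiveInfo y n))
        (λ z z<y → proj₁ (positive z z<y) ,
                   subst (Eval X noPositiveInfoC (z ∷ n ∷ [])) (proj₂ (positive z z<y)) (ev-noPositiveInfo z n)))
      ev-one

    positiveInfo-sound : ∀ n v → Eval X positiveInfoC (n ∷ []) v → v ≡ 1 × ∃ λ l → X (triple n 1 l) ≡ true
    positiveInfo-sound n v (ev-comp (ea-cons (ev-mu {y = y} zy _) ea-nil) e1) =
      eval-functional e1 ev-one , y , zero-noPositiveInfo n y (eval-functional (ev-noPositiveInfo y n) zy)

  -- A generic oracle for a density-1 set D answers positively on a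
  -- density-1 set: its domain meets D in the positive answers.
  positive-answers-dense : ∀ {D X} → Density1 D → GenericOracle D X →
    Density1ᴾ (λ n → ∃ λ l → X (triple n 1 l) ≡ true)
  positive-answers-dense {D} {X} dD (partial , dX) = density1-mono positive (density1-∩ dX dD)
    where
    positive : ∀ n → dom X n × D n ≡ true → ∃ λ l → X (triple n 1 l) ≡ true
    positive n ((x , l , inX) , Dn) with partial n x l inX
    ... | inj₁ (_ , ¬Dn) with trans (sym Dn) ¬Dn
    ... | ()
    positive n ((x , l , inX) , Dn) | inj₂ (refl , _) = l , inX

  -- If D is density-1 and D ⊆ C, then D ≥g C: answer 1 on the positive
  -- information of the oracle.
  subset-reduction : ∀ {C D : Real} → Density1 D → D ⊆ᴿ C → D ≥g C
  subset-reduction {C} {D} dD D⊆C = positiveInfoC , λ X gen →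
    density1-mono (λ n (l , inX) → 1 , positiveInfo-halts {X} n l inX) (positive-answers-dense {D} {X} dD gen) ,
    correct X gen
    where
    correct : ∀ X → GenericOracle D X → ∀ n v → Eval X positiveInfoC (n ∷ []) v →
      (v ≡ 0 × C n ≡ false) ⊎ (v ≡ 1 × C n ≡ true)
    correct X (partial , _) n v e with positiveInfo-sound n v e
    ... | v≡1 , l , inX with partial n 1 l inX
    ... | inj₂ (_ , Dn) = inj₂ (v≡1 , D⊆C n Dn)

  density1-≥g-refl : ∀ {A} → Density1 A → A ≥g A
  density1-≥g-refl dA = subset-reduction dA (λ n An → An)

  _∩ᴿ_ : Real → Real → Real
  (A ∩ᴿ B) n = A n ∧ B n

  ∩-density1 : ∀ {A B} → Density1 A → Density1 B → Density1 (A ∩ᴿ B)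
  ∩-density1 dA dB = density1-mono (λ n (An , Bn) → ∧-true An Bn) (density1-∩ dA dB)
    where
    ∧-true : ∀ {a b} → a ≡ true → b ≡ true → (a ∧ b) ≡ true
    ∧-true refl refl = refl

  ∩-⊆ˡ : ∀ A B → (A ∩ᴿ B) ⊆ᴿ A
  ∩-⊆ˡ A B n eq with A n
  ... | true = refl

  ∩-⊆ʳ : ∀ A B → (A ∩ᴿ B) ⊆ᴿ B
  ∩-⊆ʳ A B n eq with A n
  ... | true = eq

  -- restrictC φ runs φ and additionally waits for positive information.
  restrictC : Code 1 → Code 1
  restrictC φ = comp (proj zero) (φ ∷ positiveInfoC ∷ [])

  -- If B is density-1 and B ≥g A, then B ≥g A ∩ B: where positive
  -- information about n ∈ B appears, the answer for A is also the one
  -- for A ∩ B.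
  ∩-reduction : ∀ {A B : Real} → Density1 B → B ≥g A → B ≥g (A ∩ᴿ B)
  ∩-reduction {A} {B} dB (φ , φ-computes) = restrictC φ , λ X gen →
    density1-mono (halts X gen) (density1-∩ (proj₁ (φ-computes X gen)) (positive-answers-dense {B} {X} dB gen)) ,
    correct X gen
    where
    halts : ∀ X → GenericOracle B X → ∀ n → (∃ λ v → Eval X φ (n ∷ []) v) × (∃ λ l → X (triple n 1 l) ≡ true) →
      ∃ λ v → Eval X (restrictC φ) (n ∷ []) v
    halts X _ n ((v , e) , l , inX) = v , ev-comp (ea-cons e (ea-cons (positiveInfo-halts {X} n l inX) ea-nil)) ev-proj
    correct : ∀ X → GenericOracle B X → ∀ n v → Eval X (restrictC φ) (n ∷ []) v →
      (v ≡ 0 × (A ∩ᴿ B) n ≡ false) ⊎ (v ≡ 1 × (A ∩ᴿ B) n ≡ true)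
    correct X gen@(partial , _) n v (ev-comp (ea-cons e (ea-cons ep ea-nil)) ev-proj)
      with proj₂ (φ-computes X gen) n v e
    ... | inj₁ (v≡0 , ¬An) rewrite ¬An = inj₁ (v≡0 , refl)
    ... | inj₂ (v≡1 , An) with positiveInfo-sound n _ ep
    ... | _ , l , inX with partial n 1 l inX
    ... | inj₂ (_ , Bn) rewrite An | Bn = inj₂ (v≡1 , refl)

  positiveStages-generic : ∀ {A B : Real} {φ X} → Density1 B → B ⊆ᴿ A →
    GenericComputation φ X B → GenericOracle A (positiveStages X φ)
  positiveStages-generic {A} {B} {φ} {X} dB B⊆A (dφ , φ-correct) = partial , dense
    where
    partial : PartialOracle A (positiveStages X φ)
    partial n x l inY with positiveStages-sound X φ (triple n x l) inY
    ... | n' , l' , eq , found with triple-injective n x l n' 1 l' eq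
    ... | refl , refl , refl with φ-correct n 1 (clocked-sound X φ l' (n ∷ []) 1 found)
    ... | inj₂ (_ , Bn) = inj₂ (refl , B⊆A n Bn)
    staged : ∀ n → (∃ λ v → Eval X φ (n ∷ []) v) × B n ≡ true → dom (positiveStages X φ) n
    staged n ((v , e) , Bn) with φ-correct n v e
    ... | inj₁ (_ , ¬Bn) with trans (sym Bn) ¬Bn
    ... | ()
    staged n ((v , e) , Bn) | inj₂ (refl , _) with clocked-complete X e
    ... | l , found = 1 , l , positiveStages-complete X φ n l found
    dense : Density1ᴾ (dom (positiveStages X φ))
    dense = density1-mono staged (density1-∩ dφ dB)

  subset-composition : ∀ {A₀ B₀ A B : Real} → Density1 B → B ⊆ᴿ A → B₀ ≥g B → A ≥g A₀ → B₀ ≥g A₀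
  subset-composition {A₀} {B₀} dB B⊆A (φ , φ-computes) (ψ , ψ-computes) = relativize ψ (positiveStagesC φ) , composed
    where
    composed : ∀ X → GenericOracle B₀ X → GenericComputation (relativize ψ (positiveStagesC φ)) X A₀
    composed X gen =
      density1-mono (λ n (v , e) → v , relativize-complete computes-Y e) (proj₁ ψ-on-Y) ,
      λ n v e → proj₂ ψ-on-Y n v (relativize-sound computes-Y ψ e)
      where
      computes-Y : ∀ q → Eval X (positiveStagesC φ) (q ∷ []) (bit (positiveStages X φ q))
      computes-Y = ev-positiveStages X φ
      ψ-on-Y : GenericComputation ψ (positiveStages X φ) A₀
      ψ-on-Y = ψ-computes (positiveStages X φ) (positiveStages-generic dB B⊆A (φ-computes X gen))

  SubsetRepresentatives : Real → Real → Set
  SubsetRepresentatives A₀ B₀ = ∃ λ (B : Real) → ∃ λ (A : Real) →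
    (B ≡g B₀) × (A ≡g A₀) × Density1 A × Density1 B × (B ⊆ᴿ A)

  representatives-of-reduction : ∀ {A₀ B₀} → Density1 A₀ → Density1 B₀ →
    B₀ ≥g A₀ → SubsetRepresentatives A₀ B₀
  representatives-of-reduction {A₀} {B₀} dA₀ dB₀ B₀≥A₀ = A₀ ∩ᴿ B₀ , A₀ ,
    (subset-reduction (∩-density1 dA₀ dB₀) (∩-⊆ʳ A₀ B₀) , ∩-reduction dB₀ B₀≥A₀) ,
    (density1-≥g-refl dA₀ , density1-≥g-refl dA₀) ,
    dA₀ , ∩-density1 dA₀ dB₀ , ∩-⊆ˡ A₀ B₀

  reduction-of-representatives : ∀ {A₀ B₀} → SubsetRepresentatives A₀ B₀ → B₀ ≥g A₀
  reduction-of-representatives (_ , _ , (_ , B₀≥B) , (A≥A₀ , _) , _ , dB , B⊆A) =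
    subset-composition dB B⊆A B₀≥B A≥A₀

open Reductions

mainTheorem17 : (A₀ B₀ : Real) → Density1 A₀ → Density1 B₀ →
    ((B₀ ≥g A₀) ⇔ (∃ λ (B : Real) → ∃ λ (A : Real) →
    (B ≡g B₀) × (A ≡g A₀) × Density1 A × Density1 B × (B ⊆ᴿ A)))
mainTheorem17 A₀ B₀ dA₀ dB₀ =
  mk⇔ (representatives-of-reduction dA₀ dB₀) reduction-of-representatives
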